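{- Let $d$ be an even positive integer, let $G$ be a finite connected graph and $f_E:E\to\mathbb{Z}_d$ an e-labeling such that $(G,f_E)$ has the even cycle property. Let $C$ be any cycle of odd length in $G$. Then $(G,f_E)$ has the odd cycle property if and only if $\frac d2\sum_{l=1}^{2k+1}f_E(e_l)\equiv0\pmod d$, where $e_1,\dots,e_{2k+1}$ are the edges of $C$.
   Context: $\mathbb{Z}_d$ denotes the integers modulo $d$. A cycle of length $k$ is a closed walk, not necessarily simple: vertices $v_1,\dots,v_k$ (repetitions allowed) and edges $e_1,\dots,e_k$ with $e_i=(v_i,v_{i+1})$ for $i<k$ and $e_k=(v_k,v_1)$. $(G,f_E)$ has the even cycle property if every cycle of even length, with edges $e_1,\dots,e_{2k}$, satisfies $\sum_{l\text{ odd}}f_E(e_l)\equiv\sum_{l\text{ even}}f_E(e_l)\pmod d$. $(G,f_E)$ has the odd cycle property if every cycle of odd length, with edges $e_1,\dots,e_{2k+1}$, satisfies $\frac d2\sum_{l=1}^{2k+1}f_E(e_l)\equiv0\pmod d$. -}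

module Defs where

open import Data.Nat using (ℕ; zero; suc; _+_; _*_; _%_; _/_; NonZero)
open import Data.Nat.Divisibility using (_∣_)
open import Data.Fin using (Fin; zero; suc; toℕ; inject₁; fromℕ)
open import Data.Product using (_×_; Σ; ∃)
open import Data.Sum using (_⊎_)
import Data.Bool
open Data.Bool using (if_then_else_)
open import Relation.Binary.PropositionalEquality using (_≡_; _≢_)
open import Relation.Nullary using (¬_)

-- A finite simple graph with vertex set Fin n and edge set Fin m.
-- Edge e has (unordered) endpoints src e and tgt e.
record Graph (n m : ℕ) : Set where
  field
    src tgt  : Fin m → Fin n
    loopless : ∀ e → src e ≢ tgt e
    noMulti  : ∀ e e' →
               ((src e ≡ src e' × tgt e ≡ tgt e') ⊎ (src e ≡ tgt e' × tgt e ≡ src e')) →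
               e ≡ e'
open Graph public

Joins : ∀ {n m} → Graph n m → Fin m → Fin n → Fin n → Set
Joins G e a b = (src G e ≡ a × tgt G e ≡ b) ⊎ (src G e ≡ b × tgt G e ≡ a)

record Walk {n m : ℕ} (G : Graph n m) : Set where
  field
    len   : ℕ
    vtx   : Fin (suc len) → Fin n
    edge  : Fin len → Fin m
    joins : ∀ i → Joins G (edge i) (vtx (inject₁ i)) (vtx (suc i))
open Walk public

-- A cycle (closed walk, repetitions allowed): a walk ending where it starts.
-- Its edges are edge 0, …, edge (len-1), i.e. e_1,…,e_len in 1-based numbering.
record Cycle {n m : ℕ} (G : Graph n m) : Set where
  field
    walk   : Walk G
    closed : vtx walk (fromℕ (len walk)) ≡ vtx walk zero
open Cycle public

clen : ∀ {n m} {G : Graph n m} → Cycle G → ℕ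


clen C = len (walk C)

cedge : ∀ {n m} {G : Graph n m} (C : Cycle G) → Fin (clen C) → Fin m
cedge C = edge (walk C)

Connected : ∀ {n m} → Graph n m → Set
Connected G = ∀ a b → Σ (Walk G) λ w → vtx w zero ≡ a × vtx w (fromℕ (len w)) ≡ b

Σ[_] : (L : ℕ) → (Fin L → ℕ) → ℕ
Σ[ zero ] f = zero
Σ[ suc L ] f = f zero + Σ[ L ] (λ i → f (suc i))

CongMod : (d : ℕ) → .{{NonZero d}} → ℕ → ℕ → Set
CongMod d a b = a % d ≡ b % d

EvenN OddN : ℕ → Set
EvenN k = ∃ λ j → k ≡ 2 * j
OddN k = ∃ λ j → k ≡ suc (2 * j)

isEvenB : ℕ → Data.Bool.Bool
isEvenB zero = Data.Bool.true
isEvenB (suc k) = Data.Bool.not (isEvenB k)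

module _ {n m d : ℕ} (G : Graph n m) (f : Fin m → Fin d) where
  -- Σ_{l odd} f(e_l) (1-based l), i.e. 0-based indices i even
  sumOddPos : Cycle G → ℕ
  sumOddPos C = Σ[ clen C ] λ i → if isEvenB (toℕ i) then toℕ (f (cedge C i)) else 0
  -- Σ_{l even} f(e_l) (1-based l), i.e. 0-based indices i odd
  sumEvenPos : Cycle G → ℕ
  sumEvenPos C = Σ[ clen C ] λ i → if isEvenB (toℕ i) then 0 else toℕ (f (cedge C i))
  sumAll : Cycle G → ℕ
  sumAll C = Σ[ clen C ] λ i → toℕ (f (cedge C i))

  module _ .{{_ : NonZero d}} where
    EvenCycleProperty : Set
    EvenCycleProperty = ∀ (C : Cycle G) → EvenN (clen C) →
      CongMod d (sumOddPos C) (sumEvenPos C)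

    OddCycleCondition : Cycle G → Set
    OddCycleCondition C = CongMod d ((d / 2) * sumAll C) 0

    OddCycleProperty : Set
    OddCycleProperty = ∀ (C : Cycle G) → OddN (clen C) → OddCycleCondition C

module Submission where

-- Write h = d/2.  Since d is even, h·s ≡ 0 (mod d) holds exactly when s is
-- even, so the odd cycle condition for a cycle says that its total label sum is even.
-- The even cycle property makes the total sum of every even cycle even: its two
-- alternating sums are congruent modulo the even number d, so they have the same parity.
-- Now let C and C' be odd cycles, starting at a and a'.  By connectivity there is a path
-- q from a' to a, and the closed walk C' · q · C · q⁻¹ has even length and total sum
-- S(C') + S(q) + S(C) + S(q).  Hence S(C') and S(C) have the same parity, and the
-- condition for the single odd cycle C transfers to every odd cycle C'.

open import Defs
open import Data.Nat using (ℕ; NonZero; zero; suc; _+_; _*_; _%_; _/_)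
open import Data.Nat.Properties
  using (+-identityʳ; +-assoc; +-comm; +-commutativeSemigroup; m*n≢0⇒m≢0)
open import Data.Nat.DivMod using (m≡m%n+[m/n]*n; m*n/n≡m; m*n%n≡0)
open import Data.Nat.Divisibility
  using (_∣_; divides; ∣m∣n⇒∣m+n; ∣m+n∣m⇒∣n; n∣m*n; ∣-trans; *-monoʳ-∣; *-cancelˡ-∣; m%n≡0⇔n∣m)
open import Data.Nat.Tactic.RingSolver using (solve-∀)
open import Algebra.Properties.CommutativeSemigroup +-commutativeSemigroup using (interchange)
open import Data.Fin using (Fin; zero; suc; toℕ; inject₁; fromℕ)
open import Data.Bool using (Bool; true; false; if_then_else_)
open import Data.Product using (_,_)
open import Data.Sum using (inj₁; inj₂)
open import Function.Bundles using (_⇔_; mk⇔; Equivalence)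
open import Function.Properties.Equivalence using () renaming (trans to ⇔-trans)
open import Relation.Binary.PropositionalEquality
  using (_≡_; refl; sym; trans; cong; cong₂; subst; module ≡-Reasoning)

Σ-cong : ∀ L {f g : Fin L → ℕ} → (∀ i → f i ≡ g i) → Σ[ L ] f ≡ Σ[ L ] g
Σ-cong zero    f≡g = refl
Σ-cong (suc L) f≡g = cong₂ _+_ (f≡g zero) (Σ-cong L (λ i → f≡g (suc i)))

Σ-+ : ∀ L (f g : Fin L → ℕ) → Σ[ L ] (λ i → f i + g i) ≡ Σ[ L ] f + Σ[ L ] g
Σ-+ zero    f g = refl
Σ-+ (suc L) f g = trans (cong (f zero + g zero +_) (Σ-+ L (λ i → f (suc i)) (λ i → g (suc i))))
                        (interchange (f zero) (g zero) _ _)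

Σ-ones : ∀ L → Σ[ L ] (λ _ → 1) ≡ L
Σ-ones zero    = refl
Σ-ones (suc L) = cong suc (Σ-ones L)

Σ-select : ∀ L (b : Fin L → Bool) (g : Fin L → ℕ) →
  Σ[ L ] (λ i → if b i then g i else 0) + Σ[ L ] (λ i → if b i then 0 else g i) ≡ Σ[ L ] g
Σ-select L b g = trans (sym (Σ-+ L _ _)) (Σ-cong L (λ i → select (b i) (g i)))
  where
  select : ∀ c x → (if c then x else 0) + (if c then 0 else x) ≡ x
  select true  x = +-identityʳ x
  select false x = refl

-- Numbers congruent modulo an even d have the same parity, so their sum is even.
congMod-even⇒even-sum : ∀ d .{{_ : NonZero d}} → 2 ∣ d → ∀ a b → a % d ≡ b % d → 2 ∣ a + b
congMod-even⇒even-sum d 2∣d a b a≡b = subst (2 ∣_) (sym decompose)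
  (∣m∣n⇒∣m+n (divides (a % d) (double (a % d))) (∣-trans 2∣d (n∣m*n (a / d + b / d))))
  where
  double : ∀ x → x + x ≡ x * 2
  double = solve-∀
  regroup : ∀ x p q d → (x + p * d) + (x + q * d) ≡ (x + x) + (p + q) * d
  regroup = solve-∀
  decompose : a + b ≡ (a % d + a % d) + (a / d + b / d) * d
  decompose = begin
    a + b                                      ≡⟨ cong₂ _+_ (m≡m%n+[m/n]*n a d) (m≡m%n+[m/n]*n b d) ⟩
    (a % d + a / d * d) + (b % d + b / d * d)  ≡⟨ cong (λ r → (a % d + a / d * d) + (r + b / d * d)) (sym a≡b) ⟩
    (a % d + a / d * d) + (a % d + b / d * d)  ≡⟨ regroup (a % d) (a / d) (b / d) d ⟩
    (a % d + a % d) + (a / d + b / d) * d      ∎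
    where open ≡-Reasoning

-- For d = 2h, the multiple h·s is divisible by d exactly when s is even.  This turns the
-- odd cycle condition into a parity statement.
half-multiple⇔even : ∀ d .{{_ : NonZero d}} → 2 ∣ d → ∀ s → (d / 2 * s) % d ≡ 0 % d ⇔ 2 ∣ s
half-multiple⇔even .(h * 2) ⦃ d≢0 ⦄ (divides h refl) s
  rewrite m*n/n≡m h 2 ⦃ _ ⦄ | m*n%n≡0 0 (h * 2) ⦃ d≢0 ⦄ =
  ⇔-trans (m%n≡0⇔n∣m (h * s) (h * 2)) (mk⇔ (*-cancelˡ-∣ h {{m*n≢0⇒m≢0 h}}) (*-monoʳ-∣ h))

-- Going around two odd closed walks and twice along a connecting path takes an even
-- number of steps.
odd+odd+double-even : ∀ {a b} → OddN a → OddN b → ∀ s → EvenN (a + (s + (b + s)))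
odd+odd+double-even (j , refl) (k , refl) s = suc (j + k + s) , regroup j k s
  where
  regroup : ∀ j k s → suc (2 * j) + (s + (suc (2 * k) + s)) ≡ 2 * suc (j + k + s)
  regroup = solve-∀

even-transfer : ∀ a b s → 2 ∣ a + (s + (b + s)) → 2 ∣ b → 2 ∣ a
even-transfer a b s 2∣total 2∣b =
  ∣m+n∣m⇒∣n (subst (2 ∣_) (regroup a b s) 2∣total) (∣m∣n⇒∣m+n 2∣b (n∣m*n s))
  where
  regroup : ∀ a b s → a + (s + (b + s)) ≡ (b + s * 2) + a
  regroup = solve-∀

module Paths {n m : ℕ} (G : Graph n m) where

  data Path : Fin n → Fin n → Set where
    []   : ∀ {a} → Path a a
    step : ∀ {a b c} (e : Fin m) → Joins G e a b → Path b c → Path a c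

  weight : (Fin m → ℕ) → ∀ {a b} → Path a b → ℕ
  weight g []           = 0
  weight g (step e _ p) = g e + weight g p

  length : ∀ {a b} → Path a b → ℕ
  length = weight (λ _ → 1)

  _++_ : ∀ {a b c} → Path a b → Path b c → Path a c
  []         ++ q = q
  step e j p ++ q = step e j (p ++ q)

  flipJoins : ∀ {e a b} → Joins G e a b → Joins G e b a
  flipJoins (inj₁ p) = inj₂ p
  flipJoins (inj₂ p) = inj₁ p

  reverse : ∀ {a b} → Path a b → Path b a
  reverse []           = []
  reverse (step e j p) = reverse p ++ step e (flipJoins j) []

  weight-++ : ∀ g {a b c} (p : Path a b) (q : Path b c) → weight g (p ++ q) ≡ weight g p + weight g q
  weight-++ g []           q = refl
  weight-++ g (step e j p) q = trans (cong (g e +_) (weight-++ g p q)) (sym (+-assoc (g e) _ _))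

  weight-reverse : ∀ g {a b} (p : Path a b) → weight g (reverse p) ≡ weight g p
  weight-reverse g []           = refl
  weight-reverse g (step e j p) = begin
    weight g (reverse p ++ step e (flipJoins j) []) ≡⟨ weight-++ g (reverse p) _ ⟩
    weight g (reverse p) + (g e + 0)                ≡⟨ cong₂ _+_ (weight-reverse g p) (+-identityʳ (g e)) ⟩
    weight g p + g e                                ≡⟨ +-comm (weight g p) (g e) ⟩
    g e + weight g p                                ∎
    where open ≡-Reasoning

  retype : ∀ {a b a' b'} → a ≡ a' → b ≡ b' → Path a b → Path a' b'
  retype refl refl p = p

  weight-retype : ∀ g {a b a' b'} (x : a ≡ a') (y : b ≡ b') (p : Path a b) →
                  weight g (retype x y p) ≡ weight g p
  weight-retype g refl refl p = refl

  pathAlong : ∀ L (v : Fin (suc L) → Fin n) (e : Fin L → Fin m) →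
              (∀ i → Joins G (e i) (v (inject₁ i)) (v (suc i))) → Path (v zero) (v (fromℕ L))
  pathAlong zero    v e j = []
  pathAlong (suc L) v e j =
    step (e zero) (j zero) (pathAlong L (λ i → v (suc i)) (λ i → e (suc i)) (λ i → j (suc i)))

  weight-pathAlong : ∀ g L v e j → weight g (pathAlong L v e j) ≡ Σ[ L ] (λ i → g (e i))
  weight-pathAlong g zero    v e j = refl
  weight-pathAlong g (suc L) v e j = cong (g (e zero) +_) (weight-pathAlong g L _ _ _)

  walkPath : (w : Walk G) → Path (vtx w zero) (vtx w (fromℕ (len w)))
  walkPath w = pathAlong (len w) (vtx w) (edge w) (joins w)

  weight-walkPath : ∀ g w → weight g (walkPath w) ≡ Σ[ len w ] (λ i → g (edge w i))
  weight-walkPath g w = weight-pathAlong g (len w) (vtx w) (edge w) (joins w)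

  connecting : Connected G → ∀ a b → Path a b
  connecting conn a b with conn a b
  ... | w , first , last = retype first last (walkPath w)

  cycleWeight : (Fin m → ℕ) → Cycle G → ℕ
  cycleWeight g C = Σ[ clen C ] (λ i → g (cedge C i))

  cycleWeight-ones : ∀ C → cycleWeight (λ _ → 1) C ≡ clen C
  cycleWeight-ones C = Σ-ones (clen C)

  start : Cycle G → Fin n
  start C = vtx (walk C) zero

  cyclePath : (C : Cycle G) → Path (start C) (start C)
  cyclePath C = retype refl (closed C) (walkPath (walk C))

  weight-cyclePath : ∀ g C → weight g (cyclePath C) ≡ cycleWeight g C
  weight-cyclePath g C = trans (weight-retype g refl (closed C) _) (weight-walkPath g (walk C))

  vertexAt : ∀ {a b} (p : Path a b) → Fin (suc (length p)) → Fin n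
  vertexAt {a} []           _       = a
  vertexAt {a} (step e j p) zero    = a
  vertexAt     (step e j p) (suc i) = vertexAt p i

  edgeAt : ∀ {a b} (p : Path a b) → Fin (length p) → Fin m
  edgeAt (step e j p) zero    = e
  edgeAt (step e j p) (suc i) = edgeAt p i

  vertexAt-first : ∀ {a b} (p : Path a b) → vertexAt p zero ≡ a
  vertexAt-first []           = refl
  vertexAt-first (step e j p) = refl

  vertexAt-last : ∀ {a b} (p : Path a b) → vertexAt p (fromℕ (length p)) ≡ b
  vertexAt-last []           = refl
  vertexAt-last (step e j p) = vertexAt-last p

  edgeAt-joins : ∀ {a b} (p : Path a b) i →
                 Joins G (edgeAt p i) (vertexAt p (inject₁ i)) (vertexAt p (suc i))
  edgeAt-joins (step e j p) zero    = subst (Joins G e _) (sym (vertexAt-first p)) j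
  edgeAt-joins (step e j p) (suc i) = edgeAt-joins p i

  pathCycle : ∀ {a} → Path a a → Cycle G
  pathCycle p = record
    { walk   = record { len = length p ; vtx = vertexAt p ; edge = edgeAt p ; joins = edgeAt-joins p }
    ; closed = trans (vertexAt-last p) (sym (vertexAt-first p))
    }

  Σ-edgeAt : ∀ g {a b} (p : Path a b) → Σ[ length p ] (λ i → g (edgeAt p i)) ≡ weight g p
  Σ-edgeAt g []           = refl
  Σ-edgeAt g (step e j p) = cong (g e +_) (Σ-edgeAt g p)

  splice : (C' C : Cycle G) → Path (start C') (start C) → Cycle G
  splice C' C q = pathCycle (cyclePath C' ++ (q ++ (cyclePath C ++ reverse q)))

  cycleWeight-splice : ∀ g C' C q → cycleWeight g (splice C' C q) ≡
                       cycleWeight g C' + (weight g q + (cycleWeight g C + weight g q))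
  cycleWeight-splice g C' C q = begin
    cycleWeight g (splice C' C q)
      ≡⟨ Σ-edgeAt g (cyclePath C' ++ (q ++ (cyclePath C ++ reverse q))) ⟩
    weight g (cyclePath C' ++ (q ++ (cyclePath C ++ reverse q)))
      ≡⟨ weight-++ g (cyclePath C') _ ⟩
    weight g (cyclePath C') + weight g (q ++ (cyclePath C ++ reverse q))
      ≡⟨ cong (weight g (cyclePath C') +_) (weight-++ g q _) ⟩
    weight g (cyclePath C') + (weight g q + weight g (cyclePath C ++ reverse q))
      ≡⟨ cong (λ r → weight g (cyclePath C') + (weight g q + r)) (weight-++ g (cyclePath C) _) ⟩
    weight g (cyclePath C') + (weight g q + (weight g (cyclePath C) + weight g (reverse q)))
      ≡⟨ cong₂ (λ x y → x + (weight g q + y)) (weight-cyclePath g C')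
               (cong₂ _+_ (weight-cyclePath g C) (weight-reverse g q)) ⟩
    cycleWeight g C' + (weight g q + (cycleWeight g C + weight g q))
      ∎
    where open ≡-Reasoning

  clen-splice : ∀ C' C q → clen (splice C' C q) ≡ clen C' + (length q + (clen C + length q))
  clen-splice C' C q = begin
    clen (splice C' C q)
      ≡⟨ sym (cycleWeight-ones (splice C' C q)) ⟩
    cycleWeight (λ _ → 1) (splice C' C q)
      ≡⟨ cycleWeight-splice (λ _ → 1) C' C q ⟩
    cycleWeight (λ _ → 1) C' + (length q + (cycleWeight (λ _ → 1) C + length q))
      ≡⟨ cong₂ (λ x y → x + (length q + (y + length q))) (cycleWeight-ones C') (cycleWeight-ones C) ⟩
    clen C' + (length q + (clen C + length q))
      ∎
    where open ≡-Reasoning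

module _ (d : ℕ) .{{_ : NonZero d}} (2∣d : 2 ∣ d) {n m : ℕ} (G : Graph n m) (f : Fin m → Fin d) where
  open Paths G

  -- Under the even cycle property every even cycle has an even label sum, since its two
  -- alternating sums are congruent modulo the even number d.
  even-cycle-even-sum : EvenCycleProperty G f → ∀ K → EvenN (clen K) → 2 ∣ sumAll G f K
  even-cycle-even-sum evenP K evenK =
    subst (2 ∣_) (Σ-select (clen K) _ _) (congMod-even⇒even-sum d 2∣d _ _ (evenP K evenK))

  -- In a connected graph with the even cycle property, all odd cycles have label sums of
  -- the same parity: splice them into one even cycle through a connecting path.
  odd-cycle-parity-transfer : Connected G → EvenCycleProperty G f →
    ∀ C C' → OddN (clen C) → OddN (clen C') → 2 ∣ sumAll G f C → 2 ∣ sumAll G f C'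
  odd-cycle-parity-transfer conn evenP C C' oddC oddC' 2∣sumC =
    even-transfer (sumAll G f C') (sumAll G f C) (weight label q) 2∣sumK 2∣sumC
    where
    label : Fin m → ℕ
    label e = toℕ (f e)
    q : Path (start C') (start C)
    q = connecting conn (start C') (start C)
    evenK : EvenN (clen (splice C' C q))
    evenK = subst EvenN (sym (clen-splice C' C q)) (odd+odd+double-even oddC' oddC (length q))
    2∣sumK : 2 ∣ sumAll G f C' + (weight label q + (sumAll G f C + weight label q))
    2∣sumK = subst (2 ∣_) (cycleWeight-splice label C' C q)
                   (even-cycle-even-sum evenP (splice C' C q) evenK)

-- By half-multiple⇔even both conditions are parity statements about
-- label sums, and the parity transfers from C to every odd cycle.
lemma1 : (d : ℕ) .{{_ : NonZero d}} → 2 ∣ d →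
         {n m : ℕ} (G : Graph n m) → Connected G →
         (f : Fin m → Fin d) → EvenCycleProperty G f →
         (C : Cycle G) → OddN (clen C) →
         (OddCycleProperty G f ⇔ OddCycleCondition G f C)
lemma1 d 2∣d G conn f evenP C oddC = mk⇔ (λ oddP → oddP C oddC) fromSingleCycle
  where
  open Equivalence
  condition⇔even : ∀ C' → OddCycleCondition G f C' ⇔ 2 ∣ sumAll G f C'
  condition⇔even C' = half-multiple⇔even d 2∣d (sumAll G f C')
  fromSingleCycle : OddCycleCondition G f C → OddCycleProperty G f
  fromSingleCycle condC C' oddC' = from (condition⇔even C')
    (odd-cycle-parity-transfer d 2∣d G f conn evenP C C' oddC oddC' (to (condition⇔even C) condC))
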